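{- Let $t$ be a term with $\mathrm{normal}_{\mathrm{cbv}}(t)$ and let $\Phi$ be a derivation in the CbV type system of $\Gamma\vdash^{(m,e)} t:\mathbf 0$. Then $\Gamma$ is empty (so $\Phi$ is tight) and $m=e=0$.
   Context: Terms: $t,s ::= x \mid \lambda x.t \mid t\,s \mid t[x\leftarrow s]$, where $t[x\leftarrow s]$ (explicit substitution) binds $x$ in $t$. $\mathrm{normal}_{\mathrm{cbv}}$: least predicate with $\mathrm{normal}_{\mathrm{cbv}}(\lambda x.t)$ and ($\mathrm{normal}_{\mathrm{cbv}}(t)$ and $\mathrm{normal}_{\mathrm{cbv}}(s)$) $\Rightarrow\mathrm{normal}_{\mathrm{cbv}}(t[x\leftarrow s])$. CbV types: linear types $L ::= M\to N$; multi types $M,N ::= [L_i]_{i\in J}$ finite multisets, $\mathbf 0$ empty multiset, $\uplus$ union. Type contexts $\Gamma$ map variables to multi types, all but finitely many to $\mathbf 0$; $\mathrm{dom}(\Gamma)=\{x\mid\Gamma(x)\ne\mathbf 0\}$; $\Gamma$ empty if its domain is empty; $\uplus$ pointwise; $\Gamma,x:M$ means $\Gamma\uplus(x\mapsto M)$ with $x\notin\mathrm{dom}(\Gamma)$. Rules: (ax) $x:M\vdash^{(0,1)} x:M$ for any multi type $M$; (app) from $\Gamma\vdash^{(m,e)} t:[M\to N]$ and $\Pi\vdash^{(m',e')} s:M$ infer $\Gamma\uplus\Pi\vdash^{(m+m'+1,e+e')} t\,s:N$; (fun) from $\Gamma,x:N\vdash^{(m,e)} t:M$ infer $\Gamma\vdash^{(m,e)}\lambda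 x.t:N\to M$; (many) from $\Pi_i\vdash^{(m_i,e_i)}\lambda x.t:L_i$ for $i\in J$ ($J$ finite, possibly empty) infer $\biguplus_i\Pi_i\vdash^{(\sum m_i,\sum e_i)}\lambda x.t:[L_i]_{i\in J}$; (ES) from $\Gamma,x:N\vdash^{(m,e)} t:M$ and $\Pi\vdash^{(m',e')} s:N$ infer $\Gamma\uplus\Pi\vdash^{(m+m',e+e')} t[x\leftarrow s]:M$. A derivation of $\Gamma\vdash^{(m,e)} t:M$ is tight if $M=\mathbf 0$ and $\Gamma$ is empty. -}

module Defs where

open import Data.Nat using (ℕ; zero; suc; _+_; _≡ᵇ_)
open import Data.Bool using (if_then_else_)
open import Data.List using (List; []; _∷_; _++_)
open import Relation.Binary.PropositionalEquality using (_≡_)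

Var : Set
Var = ℕ

-- Terms  t, s ::= x | λx.t | t s | t[x←s]   (ƛ x t and t [ x ← s ] bind x)
data Term : Set where
  var  : Var → Term
  ƛ    : Var → Term → Term
  _·_  : Term → Term → Term
  _[_←_] : Term → Var → Term → Term

data normal-cbv : Term → Set where
  nλ  : ∀ {x t} → normal-cbv (ƛ x t)
  nES : ∀ {t x s} → normal-cbv t → normal-cbv s → normal-cbv (t [ x ← s ])

-- CbV types.  Linear types L ::= M ⇒ N ; multi types are finite multisets of
-- linear types, represented by lists taken up to the multiset equivalence ≈ᴹ below.
mutual
  data LType : Set where
    _⇒_ : MType → MType → LType

  MType : Set
  MType = List LType

𝟎 : MType
𝟎 = []

_⊎ᴹ_ : MType → MType → MType
_⊎ᴹ_ = _++_

mutual
  data _≈ᴸ_ : LType → LType → Set where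
    ⇒-cong : ∀ {M M' N N'} → M ≈ᴹ M' → N ≈ᴹ N' → (M ⇒ N) ≈ᴸ (M' ⇒ N')

  data _≈ᴹ_ : MType → MType → Set where
    []≈    : [] ≈ᴹ []
    ∷≈     : ∀ {L L' M M'} → L ≈ᴸ L' → M ≈ᴹ M' → (L ∷ M) ≈ᴹ (L' ∷ M')
    swap≈  : ∀ {L L' M} → (L ∷ L' ∷ M) ≈ᴹ (L' ∷ L ∷ M)
    trans≈ : ∀ {M M' M''} → M ≈ᴹ M' → M' ≈ᴹ M'' → M ≈ᴹ M''

Ctx : Set
Ctx = Var → MType

∅ : Ctx
∅ _ = 𝟎

_⊎ᶜ_ : Ctx → Ctx → Ctx
(Γ ⊎ᶜ Π) y = Γ y ⊎ᴹ Π y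

_↦_ : Var → MType → Ctx
(x ↦ M) y = if y ≡ᵇ x then M else 𝟎

_∖_ : Ctx → Var → Ctx
(Δ ∖ x) y = if y ≡ᵇ x then 𝟎 else Δ y

EmptyCtx : Ctx → Set
EmptyCtx Γ = ∀ y → Γ y ≡ 𝟎

-- Premise  "Γ , x : N ⊢ t"  is rendered as a premise with context Δ, where the
-- conclusion uses Γ = Δ ∖ x and N = Δ x.
-- Rule (many) over a finite family J is rendered by the nil/cons pair.
mutual
  data _⊢ᴸ_∶_⟨_,_⟩ : Ctx → Term → LType → ℕ → ℕ → Set where
    fun : ∀ {Δ x t M m e} →
          Δ ⊢ t ∶ M ⟨ m , e ⟩ →
          (Δ ∖ x) ⊢ᴸ ƛ x t ∶ (Δ x ⇒ M) ⟨ m , e ⟩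

  data _⊢_∶_⟨_,_⟩ : Ctx → Term → MType → ℕ → ℕ → Set where
    ax   : ∀ {x M} → (x ↦ M) ⊢ var x ∶ M ⟨ 0 , 1 ⟩
    app  : ∀ {Γ Π t s M M' N m e m' e'} →
           Γ ⊢ t ∶ ((M ⇒ N) ∷ []) ⟨ m , e ⟩ →
           Π ⊢ s ∶ M' ⟨ m' , e' ⟩ → M' ≈ᴹ M →
           (Γ ⊎ᶜ Π) ⊢ t · s ∶ N ⟨ m + m' + 1 , e + e' ⟩
    many-nil  : ∀ {x t} → ∅ ⊢ ƛ x t ∶ 𝟎 ⟨ 0 , 0 ⟩
    many-cons : ∀ {Γ Π x t L M m e m' e'} →
           Γ ⊢ᴸ ƛ x t ∶ L ⟨ m , e ⟩ →
           Π ⊢ ƛ x t ∶ M ⟨ m' , e' ⟩ →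
           (Γ ⊎ᶜ Π) ⊢ ƛ x t ∶ (L ∷ M) ⟨ m + m' , e + e' ⟩
    es   : ∀ {Δ Π x t s M N' m e m' e'} →
           Δ ⊢ t ∶ M ⟨ m , e ⟩ →
           Π ⊢ s ∶ N' ⟨ m' , e' ⟩ → N' ≈ᴹ Δ x →
           ((Δ ∖ x) ⊎ᶜ Π) ⊢ t [ x ← s ] ∶ M ⟨ m + m' , e + e' ⟩

module Submission where

-- The proof is an induction on the normality predicate.
--   * An abstraction typed with 𝟎 can only come from rule (many) over an
--     empty family, whose conclusion is  ∅ ⊢ λx.t ∶ 𝟎 ⟨ 0 , 0 ⟩.
--   * For t[x←s] the induction hypothesis on t empties the context Δ of t,
--     so the type Δ x assigned to x is 𝟎; the type of s is equivalent to it
--     and hence is itself 𝟎 (multiset equivalence preserves size), which lets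
--     the induction hypothesis apply to s as well.

open import Defs
open import Data.Nat using (ℕ; suc; _≡ᵇ_)
open import Data.Bool using (true; false)
open import Data.List using ([]; _∷_; _++_; length)
open import Data.Product using (_×_; _,_)
open import Relation.Binary.PropositionalEquality
  using (_≡_; refl; trans; cong; cong₂; subst)

≈ᴹ-length : ∀ {M M'} → M ≈ᴹ M' → length M ≡ length M'
≈ᴹ-length []≈          = refl
≈ᴹ-length (∷≈ _ M≈M')  = cong suc (≈ᴹ-length M≈M')
≈ᴹ-length swap≈        = refl
≈ᴹ-length (trans≈ p q) = trans (≈ᴹ-length p) (≈ᴹ-length q)

≈𝟎⇒≡𝟎 : ∀ {M} → M ≈ᴹ 𝟎 → M ≡ 𝟎
≈𝟎⇒≡𝟎 {[]}    _   = refl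
≈𝟎⇒≡𝟎 {_ ∷ _} M≈𝟎 with ≈ᴹ-length M≈𝟎
... | ()

∖-empty : ∀ {Δ} x → EmptyCtx Δ → EmptyCtx (Δ ∖ x)
∖-empty x Δ-empty y with y ≡ᵇ x
... | true  = refl
... | false = Δ-empty y

⊎ᶜ-empty : ∀ {Γ Π} → EmptyCtx Γ → EmptyCtx Π → EmptyCtx (Γ ⊎ᶜ Π)
⊎ᶜ-empty Γ-empty Π-empty y = cong₂ _++_ (Γ-empty y) (Π-empty y)

proposition7 : (t : Term) (Γ : Ctx) (m e : ℕ) → normal-cbv t →
    Γ ⊢ t ∶ 𝟎 ⟨ m , e ⟩ →
    EmptyCtx Γ × m ≡ 0 × e ≡ 0
proposition7 _ _ _ _ nλ many-nil = (λ _ → refl) , refl , refl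
proposition7 (t [ x ← s ]) _ _ _ (nES t-normal s-normal)
             (es {Δ} {Π} t-typed s-typed N'≈Δx)
  with proposition7 t Δ _ _ t-normal t-typed
... | Δ-empty , refl , refl
  -- x is typed with Δ x = 𝟎 in t, so the argument s is typed with 𝟎 too
  with ≈𝟎⇒≡𝟎 (subst (_ ≈ᴹ_) (Δ-empty x) N'≈Δx)
... | refl with proposition7 s Π _ _ s-normal s-typed
... | Π-empty , refl , refl = ⊎ᶜ-empty (∖-empty x Δ-empty) Π-empty , refl , refl
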